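{- Let $\lambda$ be a nonzero real number. For integers $n,r\ge0$ define $$S_n(x,r\mid\lambda)=\sum_{k=0}^{n}(-1)^k\binom{x}{k}(k)_{r,\lambda}.$$ Then for every positive integer $r$ and every integer $n\ge1$, $$ S_{n}(x,r\mid\lambda)=-x\sum_{j=0}^{r-1}\binom{r-1}{j}(1-\lambda)_{r-1-j,\lambda}\,S_{n-1}(x-1,j\mid\lambda). $$
   Context: For a real parameter $\mu$ the degenerate falling factorials are $(x)_{0,\mu}=1$ and $(x)_{n,\mu}=x(x-\mu)\cdots(x-(n-1)\mu)$ for $n\ge1$; $(x)_n=(x)_{n,1}$ is the usual falling factorial, and $\binom{x}{m}=(x)_m/m!$ for integers $m\ge0$. -}

module Defs where

open import Data.Nat using (ℕ; zero; suc)
open import Algebra.Bundles using (CommutativeRing)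

-- Operations in a commutative ring R in which every positive integer
-- is invertible, with a chosen inverse  inv n  of  (n+1).
module Ops {c ℓ} (R : CommutativeRing c ℓ) (inv : ℕ → CommutativeRing.Carrier R) where
  open CommutativeRing R

  ι : ℕ → Carrier
  ι zero    = 0#
  ι (suc n) = 1# + ι n

  sumTo : ℕ → (ℕ → Carrier) → Carrier
  sumTo zero    f = f 0
  sumTo (suc n) f = sumTo n f + f (suc n)

  sgn : ℕ → Carrier
  sgn zero    = 1#
  sgn (suc k) = - (sgn k)

  dff : Carrier → ℕ → Carrier → Carrier
  dff x zero    μ = 1#
  dff x (suc n) μ = dff x n μ * (x - ι n * μ)

  ff : Carrier → ℕ → Carrier
  ff x n = dff x n 1#

  invFact : ℕ → Carrier
  invFact zero    = 1#
  invFact (suc m) = invFact m * inv m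

  binom : Carrier → ℕ → Carrier
  binom x m = ff x m * invFact m

  S : ℕ → Carrier → ℕ → Carrier → Carrier
  S n x r lam = sumTo n (λ k → sgn k * binom x k * dff (ι k) r lam)

-- The k = 0 term vanishes, and for k = m+1
-- the head factor  m+1  of  (m+1)_{r+1,λ} = (m+1)((m+1)-λ)_{r,λ}  is absorbed by the binomial:
-- (m+1)(x choose m+1) = x (x-1 choose m).  Splitting  (m+1)-λ = m + (1-λ)  and expanding
-- (m + (1-λ))_{r,λ}  by the binomial theorem for degenerate falling factorials
-- (a+b)_{r,μ} = Σ_j (r choose j) (a)_{j,μ} (b)_{r-j,μ}  leaves a double sum over m and j;
-- exchanging the order of summation, the inner sums are  S_n(x-1, j | λ).
module Submission where

open import Defs
open import Data.Nat using (ℕ; zero; suc; _∸_; _≤_; z≤n) renaming (_+_ to _+ℕ_)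
open import Data.Nat.Combinatorics using (_C_; nCk+nC[k+1]≡[n+1]C[k+1]; k>n⇒nCk≡0)
open import Data.Nat.Properties using (≤-refl; m≤n⇒m≤1+n; n<1+n; m+[n∸m]≡n; +-∸-assoc)
open import Algebra.Bundles using (CommutativeRing)
open import Relation.Nullary using (¬_)
open import Relation.Binary.PropositionalEquality as ≡ using (cong)

module DegenerateFactorials {c ℓ} (R : CommutativeRing c ℓ) (inv : ℕ → CommutativeRing.Carrier R) where
  open CommutativeRing R
  open Ops R inv
  open import Relation.Binary.Reasoning.Setoid setoid
  open import Algebra.Properties.Ring ring using (-‿distribˡ-*; -‿+-comm; -0#≈0#)
  open import Algebra.Solver.Ring.NaturalCoefficients.Default commutativeSemiring
    using (solve; _:=_; _:+_; _:*_)

  -‿distrib-[+]* : ∀ p q μ → - ((p + q) * μ) ≈ - (p * μ) + - (q * μ)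
  -‿distrib-[+]* p q μ = trans (-‿cong (distribʳ μ p q)) (sym (-‿+-comm (p * μ) (q * μ)))

  sumTo-cong : ∀ n {f g : ℕ → Carrier} → (∀ k → k ≤ n → f k ≈ g k) → sumTo n f ≈ sumTo n g
  sumTo-cong zero    f≈g = f≈g 0 z≤n
  sumTo-cong (suc n) f≈g = +-cong (sumTo-cong n (λ k k≤n → f≈g k (m≤n⇒m≤1+n k≤n))) (f≈g (suc n) ≤-refl)

  sumTo-+ : ∀ n (f g : ℕ → Carrier) → sumTo n (λ k → f k + g k) ≈ sumTo n f + sumTo n g
  sumTo-+ zero    f g = refl
  sumTo-+ (suc n) f g = begin
    sumTo n (λ k → f k + g k) + (f (suc n) + g (suc n))
      ≈⟨ +-congʳ (sumTo-+ n f g) ⟩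
    (sumTo n f + sumTo n g) + (f (suc n) + g (suc n))
      ≈⟨ solve 4 (λ a b c d → (a :+ b) :+ (c :+ d) := (a :+ c) :+ (b :+ d))
           refl (sumTo n f) (sumTo n g) (f (suc n)) (g (suc n)) ⟩
    (sumTo n f + f (suc n)) + (sumTo n g + g (suc n)) ∎

  sumTo-*ˡ : ∀ n a (f : ℕ → Carrier) → a * sumTo n f ≈ sumTo n (λ k → a * f k)
  sumTo-*ˡ zero    a f = refl
  sumTo-*ˡ (suc n) a f = trans (distribˡ a _ _) (+-congʳ (sumTo-*ˡ n a f))

  sumTo-*ʳ : ∀ n a (f : ℕ → Carrier) → sumTo n f * a ≈ sumTo n (λ k → f k * a)
  sumTo-*ʳ zero    a f = refl
  sumTo-*ʳ (suc n) a f = trans (distribʳ a _ _) (+-congʳ (sumTo-*ʳ n a f))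

  sumTo-sucˡ : ∀ n f → sumTo (suc n) f ≈ f 0 + sumTo n (λ k → f (suc k))
  sumTo-sucˡ zero    f = refl
  sumTo-sucˡ (suc n) f = trans (+-congʳ (sumTo-sucˡ n f)) (+-assoc _ _ _)

  sumTo-comm : ∀ n m (g : ℕ → ℕ → Carrier) →
    sumTo n (λ i → sumTo m (g i)) ≈ sumTo m (λ j → sumTo n (λ i → g i j))
  sumTo-comm zero    m g = refl
  sumTo-comm (suc n) m g =
    trans (+-congʳ (sumTo-comm n m g)) (sym (sumTo-+ m (λ j → sumTo n (λ i → g i j)) (g (suc n))))

  ι-+ : ∀ a b → ι (a +ℕ b) ≈ ι a + ι b
  ι-+ zero    b = sym (+-identityˡ _)
  ι-+ (suc a) b = trans (+-congˡ (ι-+ a b)) (sym (+-assoc _ _ _))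

  ι-C-pascal : ∀ r k → ι (suc r C suc k) ≈ ι (r C k) + ι (r C suc k)
  ι-C-pascal r k = trans (reflexive (cong ι (≡.sym (nCk+nC[k+1]≡[n+1]C[k+1] r k)))) (ι-+ (r C k) (r C suc k))

  dff-cong : ∀ {y y′} r μ → y ≈ y′ → dff y r μ ≈ dff y′ r μ
  dff-cong zero    μ y≈y′ = refl
  dff-cong (suc r) μ y≈y′ = *-cong (dff-cong r μ y≈y′) (+-congʳ y≈y′)

  dff-sucˡ : ∀ y r μ → dff y (suc r) μ ≈ y * dff (y - μ) r μ
  dff-sucˡ y zero μ = begin
    1# * (y - 0# * μ) ≈⟨ *-identityˡ _ ⟩
    y - 0# * μ        ≈⟨ +-congˡ (trans (-‿cong (zeroˡ μ)) -0#≈0#) ⟩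
    y + 0#            ≈⟨ +-identityʳ y ⟩
    y                 ≈⟨ *-identityʳ y ⟨
    y * 1#            ∎
  dff-sucˡ y (suc r) μ = begin
    dff y (suc r) μ * (y - ι (suc r) * μ)
      ≈⟨ *-cong (dff-sucˡ y r μ) (+-congˡ (trans (-‿distrib-[+]* 1# (ι r) μ) (+-congʳ (-‿cong (*-identityˡ μ))))) ⟩
    (y * D) * (y + (- μ + - (ι r * μ)))
      ≈⟨ solve 4 (λ y p q D → (y :* D) :* (y :+ (p :+ q)) := y :* (D :* ((y :+ p) :+ q)))
           refl y (- μ) (- (ι r * μ)) D ⟩
    y * (D * ((y - μ) - ι r * μ)) ∎
    where D = dff (y - μ) r μ

  dff-zero-suc : ∀ r μ → dff 0# (suc r) μ ≈ 0#
  dff-zero-suc r μ = trans (dff-sucˡ 0# r μ) (zeroˡ _)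

  module _ (a b μ : Carrier) where
    private
      A B : ℕ → Carrier
      A j = dff a j μ
      B k = dff b k μ

      term : ℕ → ℕ → Carrier
      term r j = ι (r C j) * A j * B (r ∸ j)

      raiseA raiseB : ℕ → ℕ → Carrier
      raiseA r j = ι (r C j) * A (suc j) * B (r ∸ j)
      raiseB r j = ι (r C j) * A j * B (suc r ∸ j)

      term-step : ∀ r j → j ≤ r → term r j * ((a + b) - ι r * μ) ≈ raiseA r j + raiseB r j
      term-step r j j≤r = begin
        (ι (r C j) * A j * B k) * ((a + b) - ι r * μ)
          ≈⟨ *-congˡ (+-congˡ (trans (-‿cong (*-congʳ r≈j+k)) (-‿distrib-[+]* (ι j) (ι k) μ))) ⟩
        (ι (r C j) * A j * B k) * ((a + b) + (- (ι j * μ) + - (ι k * μ)))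
          ≈⟨ solve 7 (λ c Aj Bk a b p q → (c :* Aj :* Bk) :* ((a :+ b) :+ (p :+ q))
                        := c :* (Aj :* (a :+ p)) :* Bk :+ c :* Aj :* (Bk :* (b :+ q)))
               refl (ι (r C j)) (A j) (B k) a b (- (ι j * μ)) (- (ι k * μ)) ⟩
        raiseA r j + ι (r C j) * A j * B (suc k)
          ≈⟨ +-congˡ (reflexive (cong (λ t → ι (r C j) * A j * B t) (≡.sym (+-∸-assoc 1 j≤r)))) ⟩
        raiseA r j + raiseB r j ∎
        where
          k = r ∸ j
          r≈j+k : ι r ≈ ι j + ι k
          r≈j+k = trans (reflexive (cong ι (≡.sym (m+[n∸m]≡n j≤r)))) (ι-+ j k)

      term-pascal : ∀ r k → term (suc r) (suc k) ≈ raiseA r k + raiseB r (suc k)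
      term-pascal r k = trans (*-congʳ (*-congʳ (ι-C-pascal r k)))
        (solve 4 (λ p q x y → (p :+ q) :* x :* y := p :* x :* y :+ q :* x :* y)
           refl (ι (r C k)) (ι (r C suc k)) (A (suc k)) (B (r ∸ k)))

      raiseB-top : ∀ r → raiseB r (suc r) ≈ 0#
      raiseB-top r = begin
        ι (r C suc r) * A (suc r) * B (r ∸ r) ≈⟨ *-congʳ (*-congʳ (reflexive (cong ι (k>n⇒nCk≡0 (n<1+n r))))) ⟩
        0# * A (suc r) * B (r ∸ r)            ≈⟨ trans (*-congʳ (zeroˡ _)) (zeroˡ _) ⟩
        0#                                    ∎

    dff-+ : ∀ r → dff (a + b) r μ ≈ sumTo r (λ j → ι (r C j) * dff a j μ * dff b (r ∸ j) μ)
    dff-+ zero = sym (trans (*-identityʳ _) (trans (*-identityʳ _) (+-identityʳ 1#)))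
    dff-+ (suc r) = begin
      dff (a + b) r μ * ((a + b) - ι r * μ)
        ≈⟨ *-congʳ (dff-+ r) ⟩
      sumTo r (term r) * ((a + b) - ι r * μ)
        ≈⟨ sumTo-*ʳ r _ _ ⟩
      sumTo r (λ j → term r j * ((a + b) - ι r * μ))
        ≈⟨ sumTo-cong r (term-step r) ⟩
      sumTo r (λ j → raiseA r j + raiseB r j)
        ≈⟨ sumTo-+ r (raiseA r) (raiseB r) ⟩
      sumTo r (raiseA r) + sumTo r (raiseB r)
        ≈⟨ +-congˡ (trans (sym (+-identityʳ _)) (+-congˡ (sym (raiseB-top r)))) ⟩
      sumTo r (raiseA r) + sumTo (suc r) (raiseB r)
        ≈⟨ +-congˡ (sumTo-sucˡ r (raiseB r)) ⟩
      sumTo r (raiseA r) + (raiseB r 0 + sumTo r (λ k → raiseB r (suc k)))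
        ≈⟨ solve 3 (λ p q s → p :+ (q :+ s) := q :+ (p :+ s))
             refl (sumTo r (raiseA r)) (raiseB r 0) (sumTo r (λ k → raiseB r (suc k))) ⟩
      raiseB r 0 + (sumTo r (raiseA r) + sumTo r (λ k → raiseB r (suc k)))
        ≈⟨ +-congˡ (sym (sumTo-+ r (raiseA r) (λ k → raiseB r (suc k)))) ⟩
      raiseB r 0 + sumTo r (λ k → raiseA r k + raiseB r (suc k))
        ≈⟨ +-congˡ (sumTo-cong r (λ k _ → sym (term-pascal r k))) ⟩
      term (suc r) 0 + sumTo r (λ k → term (suc r) (suc k))
        ≈⟨ sumTo-sucˡ r (term (suc r)) ⟨
      sumTo (suc r) (term (suc r)) ∎

  binom-absorption : (∀ n → ι (suc n) * inv n ≈ 1#) →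
    ∀ x m → ι (suc m) * binom x (suc m) ≈ x * binom (x - 1#) m
  binom-absorption ι-inv x m = begin
    ι (suc m) * (ff x (suc m) * (invFact m * inv m))
      ≈⟨ *-congˡ (*-congʳ (dff-sucˡ x m 1#)) ⟩
    ι (suc m) * ((x * ff (x - 1#) m) * (invFact m * inv m))
      ≈⟨ solve 5 (λ n x f i v → n :* ((x :* f) :* (i :* v)) := (x :* (f :* i)) :* (n :* v))
           refl (ι (suc m)) x (ff (x - 1#) m) (invFact m) (inv m) ⟩
    (x * binom (x - 1#) m) * (ι (suc m) * inv m)
      ≈⟨ trans (*-congˡ (ι-inv m)) (*-identityʳ _) ⟩
    x * binom (x - 1#) m ∎

  S-summand-suc : (∀ n → ι (suc n) * inv n ≈ 1#) → ∀ x lam r m →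
    sgn (suc m) * binom x (suc m) * dff (ι (suc m)) (suc r) lam
      ≈ - x * sumTo r (λ j → ι (r C j) * dff (1# - lam) (r ∸ j) lam
                                * (sgn m * binom (x - 1#) m * dff (ι m) j lam))
  S-summand-suc ι-inv x lam r m = begin
    - s * binom x (suc m) * dff (ι (suc m)) (suc r) lam
      ≈⟨ *-cong (sym (-‿distribˡ-* s _)) (dff-sucˡ (ι (suc m)) r lam) ⟩
    - (s * binom x (suc m)) * (ι (suc m) * D)
      ≈⟨ -‿distribˡ-* _ _ ⟨
    - (s * binom x (suc m) * (ι (suc m) * D))
      ≈⟨ -‿cong (solve 4 (λ s b n D → s :* b :* (n :* D) := s :* (n :* b) :* D)
                   refl s (binom x (suc m)) (ι (suc m)) D) ⟩
    - (s * (ι (suc m) * binom x (suc m)) * D)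
      ≈⟨ -‿cong (*-congʳ (*-congˡ (binom-absorption ι-inv x m))) ⟩
    - (s * (x * binom (x - 1#) m) * D)
      ≈⟨ -‿cong (solve 4 (λ s x b D → s :* (x :* b) :* D := x :* (s :* b :* D))
                   refl s x (binom (x - 1#) m) D) ⟩
    - (x * (s * binom (x - 1#) m * D))
      ≈⟨ -‿distribˡ-* _ _ ⟩
    - x * (s * binom (x - 1#) m * D)
      ≈⟨ *-congˡ (*-congˡ (trans (dff-cong r lam shift) (dff-+ (ι m) (1# - lam) lam r))) ⟩
    - x * (s * binom (x - 1#) m * sumTo r (λ j → ι (r C j) * dff (ι m) j lam * E j))
      ≈⟨ *-congˡ (trans (sumTo-*ˡ r _ _) (sumTo-cong r (λ j _ →
           solve 4 (λ a c d e → a :* (c :* d :* e) := c :* e :* (a :* d))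
             refl (s * binom (x - 1#) m) (ι (r C j)) (dff (ι m) j lam) (E j)))) ⟩
    - x * sumTo r (λ j → ι (r C j) * E j * (s * binom (x - 1#) m * dff (ι m) j lam)) ∎
    where
      s = sgn m
      D = dff (ι (suc m) - lam) r lam
      E : ℕ → Carrier
      E j = dff (1# - lam) (r ∸ j) lam
      shift : ι (suc m) - lam ≈ ι m + (1# - lam)
      shift = solve 3 (λ i l o → (o :+ i) :+ l := i :+ (o :+ l)) refl (ι m) (- lam) 1#

theorem2p8 : ∀ {c ℓ} (R : CommutativeRing c ℓ) (inv : ℕ → CommutativeRing.Carrier R) →
    let open CommutativeRing R
        open Ops R inv
    in (∀ n → ι (suc n) * inv n ≈ 1#) →
       ∀ (lam x : Carrier) → ¬ (lam ≈ 0#) →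
       ∀ (r n : ℕ) →
       S (suc n) x (suc r) lam
         ≈ - x * sumTo r (λ j → ι (r C j) * dff (1# - lam) (r ∸ j) lam * S n (x - 1#) j lam)
theorem2p8 R inv ι-inv lam x _ r n = begin
  sumTo (suc n) F
    ≈⟨ sumTo-sucˡ n F ⟩
  F 0 + sumTo n (λ m → F (suc m))
    ≈⟨ trans (+-congʳ (trans (*-congˡ (dff-zero-suc r lam)) (zeroʳ _))) (+-identityˡ _) ⟩
  sumTo n (λ m → F (suc m))
    ≈⟨ sumTo-cong n (λ m _ → S-summand-suc ι-inv x lam r m) ⟩
  sumTo n (λ m → - x * sumTo r (H m))
    ≈⟨ sumTo-*ˡ n (- x) _ ⟨
  - x * sumTo n (λ m → sumTo r (H m))
    ≈⟨ *-congˡ (sumTo-comm n r H) ⟩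
  - x * sumTo r (λ j → sumTo n (λ m → H m j))
    ≈⟨ *-congˡ (sumTo-cong r (λ j _ → sumTo-*ˡ n (ι (r C j) * E j) _)) ⟨
  - x * sumTo r (λ j → ι (r C j) * E j * S n (x - 1#) j lam) ∎
  where
    open CommutativeRing R
    open Ops R inv
    open DegenerateFactorials R inv
    open import Relation.Binary.Reasoning.Setoid setoid

    F : ℕ → Carrier
    F k = sgn k * binom x k * dff (ι k) (suc r) lam

    E : ℕ → Carrier
    E j = dff (1# - lam) (r ∸ j) lam

    H : ℕ → ℕ → Carrier
    H m j = ι (r C j) * E j * (sgn m * binom (x - 1#) m * dff (ι m) j lam)
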